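{- Let $\mathcal{D}=(P,\mathcal{B})$ be a non-trivial symmetric $(v,k,\lambda)$ design admitting a flag-transitive, point-primitive automorphism group $G$ with socle $X$, and let $x\in P$. If $t$ is a non-trivial subdegree of $X$ (the length of an orbit of $X_x$ on $P\setminus\{x\}$) and exactly $s$ orbits of $X_x$ on $P$ have length $t$, then $k$ divides $\lambda s t$.
   Context: A $2$-$(v,k,\lambda)$ design $\mathcal{D}=(P,\mathcal{B})$ consists of a set $P$ of $v$ points and a collection $\mathcal{B}$ of $b$ blocks (subsets of $P$) such that every block contains $k$ points and every pair of distinct points lies in exactly $\lambda$ blocks; it is symmetric if $b=v$ and non-trivial if $2<k<v-1$. An automorphism is a permutation of $P$ mapping $\mathcal{B}$ to itself. $G$ is flag-transitive if it is transitive on incident point-block pairs, and point-primitive if it acts primitively on $P$. The socle of $G$ is the subgroup generated by its minimal normal subgroups. $X_x$ is the stabilizer of $x$ in $X$; the subdegrees of $X$ are the lengths of the orbits of $X_x$ on $P$, the non-trivial ones being those of orbits other than $\{x\}$. -}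

module Defs where

open import Level using (Level; suc; zero)
open import Data.Nat using (ℕ; _<_; _≤_; _+_)
open import Data.Bool using (Bool; _∧_)
open import Data.Fin using (Fin)
open import Data.Fin.Subset using (Subset; _∈_; _∉_; ∣_∣)
open import Data.Fin.Permutation using (Permutation′; _⟨$⟩ʳ_; _≈_; id; flip; _∘ₚ_)
open import Data.Vec using (tabulate; lookup)
open import Data.Product using (Σ; ∃; _×_; _,_)
open import Data.Sum using (_⊎_)
open import Relation.Binary.PropositionalEquality using (_≡_; _≢_)
open import Relation.Nullary using (¬_)
open import Function.Bundles using (_⇔_)

Perm : ℕ → Set
Perm v = Permutation′ v

record PermGroup (v : ℕ) : Set₁ where
  field
    mem     : Perm v → Set
    mem-≈   : ∀ {g h} → g ≈ h → mem g → mem h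
    mem-id  : mem id
    mem-∘   : ∀ {g h} → mem g → mem h → mem (g ∘ₚ h)
    mem-inv : ∀ {g} → mem g → mem (flip g)
open PermGroup public

_≤G_ : ∀ {v} → PermGroup v → PermGroup v → Set
H ≤G K = ∀ g → mem H g → mem K g

IsTrivial : ∀ {v} → PermGroup v → Set
IsTrivial N = ∀ g → mem N g → g ≈ id

IsNormal : ∀ {v} → PermGroup v → PermGroup v → Set
IsNormal N G = N ≤G G × (∀ g n → mem G g → mem N n → mem N (flip g ∘ₚ (n ∘ₚ g)))

IsMinimalNormal : ∀ {v} → PermGroup v → PermGroup v → Set₁
IsMinimalNormal N G =
  IsNormal N G × ¬ IsTrivial N ×
  (∀ (M : PermGroup _) → IsNormal M G → M ≤G N → IsTrivial M ⊎ N ≤G M)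

IsSocle : ∀ {v} → PermGroup v → PermGroup v → Set₁
IsSocle X G =
  (∀ (N : PermGroup _) → IsMinimalNormal N G → N ≤G X) ×
  (∀ (H : PermGroup _) → (∀ (N : PermGroup _) → IsMinimalNormal N G → N ≤G H) → X ≤G H)

pairCount : ∀ {v b} → (Fin b → Subset v) → Fin v → Fin v → ℕ
pairCount B p q = ∣ tabulate (λ j → lookup (B j) p ∧ lookup (B j) q) ∣

Is2Design : (v b k lam : ℕ) → (Fin b → Subset v) → Set
Is2Design v b k lam B =
  (∀ j → ∣ B j ∣ ≡ k) × (∀ p q → p ≢ q → pairCount B p q ≡ lam)

IsNontrivialSymmetric : (v b k lam : ℕ) → (Fin b → Subset v) → Set
IsNontrivialSymmetric v b k lam B =
  Is2Design v b k lam B × b ≡ v × 2 < k × k + 1 < v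

MapsOnto : ∀ {v} → Perm v → Subset v → Subset v → Set
MapsOnto g S T = ∀ p → (p ∈ S ⇔ (g ⟨$⟩ʳ p) ∈ T)

IsAutomorphism : ∀ {v b} → (Fin b → Subset v) → Perm v → Set
IsAutomorphism {b = b} B g =
  Σ (Permutation′ b) λ σ → ∀ j → MapsOnto g (B j) (B (σ ⟨$⟩ʳ j))

IsAutGroup : ∀ {v b} → (Fin b → Subset v) → PermGroup v → Set
IsAutGroup B G = ∀ g → mem G g → IsAutomorphism B g

IsFlagTransitive : ∀ {v b} → (Fin b → Subset v) → PermGroup v → Set
IsFlagTransitive B G =
  ∀ p j p′ j′ → p ∈ B j → p′ ∈ B j′ →
    ∃ λ g → mem G g × g ⟨$⟩ʳ p ≡ p′ × MapsOnto g (B j) (B j′)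

IsTransitive : ∀ {v} → PermGroup v → Set
IsTransitive G = ∀ p q → ∃ λ g → mem G g × g ⟨$⟩ʳ p ≡ q

IsBlockOfImprimitivity : ∀ {v} → PermGroup v → Subset v → Set
IsBlockOfImprimitivity G Δ =
  ∀ g → mem G g → MapsOnto g Δ Δ ⊎ (∀ p → p ∈ Δ → (g ⟨$⟩ʳ p) ∉ Δ)

IsPrimitive : ∀ {v} → PermGroup v → Set
IsPrimitive {v} G =
  IsTransitive G ×
  (∀ Δ → IsBlockOfImprimitivity G Δ → ∣ Δ ∣ ≤ 1 ⊎ ∣ Δ ∣ ≡ v)

IsStabOrbitOf : ∀ {v} → PermGroup v → Fin v → Fin v → Subset v → Set
IsStabOrbitOf X x y O =
  ∀ z → (z ∈ O ⇔ (∃ λ h → mem X h × h ⟨$⟩ʳ x ≡ x × h ⟨$⟩ʳ y ≡ z))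

IsStabOrbit : ∀ {v} → PermGroup v → Fin v → Subset v → Set
IsStabOrbit X x O = ∃ λ y → IsStabOrbitOf X x y O

IsNontrivialStabOrbitOfLength : ∀ {v} → PermGroup v → Fin v → ℕ → Subset v → Set
IsNontrivialStabOrbitOfLength X x t O = IsStabOrbit X x O × x ∉ O × ∣ O ∣ ≡ t

IsNontrivialSubdegree : ∀ {v} → PermGroup v → Fin v → ℕ → Set
IsNontrivialSubdegree X x t = ∃ λ O → IsNontrivialStabOrbitOfLength X x t O

EnumeratesOrbitsOfLength : ∀ {v} → PermGroup v → Fin v → ℕ → (s : ℕ) → (Fin s → Subset v) → Set
EnumeratesOrbitsOfLength X x t s Os =
  (∀ i → IsNontrivialStabOrbitOfLength X x t (Os i)) ×
  (∀ i j → Os i ≡ Os j → i ≡ j) ×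
  (∀ O → IsNontrivialStabOrbitOfLength X x t O → ∃ λ i → Os i ≡ O)

module Submission where

-- Let U be the union of those s orbits.  The socle is normalised by G, so
-- the stabiliser G_x permutes the orbits of X_x preserving their lengths,
-- and U is G_x-invariant.  Counting pairs (B, p) with x ∈ B and p ∈ B ∩ U
-- gives λ ∣U∣ = λ s t, as x ∉ U.  Since G_x is transitive on the r blocks
-- through x and fixes U, each of them meets U in the same number c of
-- points, so λ s t = r c; and r = k in a symmetric design.

open import Defs
open import Data.Nat using (ℕ; _*_)
open import Data.Nat.Divisibility using (_∣_)
open import Data.Fin using (Fin)
open import Data.Fin.Subset using (Subset)

open import Data.Nat using (zero; suc; _+_; _<_; s≤s; NonZero)
open import Data.Nat.Properties
  using (+-*-semiring; +-assoc; +-comm; +-identityʳ; *-zeroʳ; *-comm; *-assoc; *-suc;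
         +-cancelˡ-≡; +-cancelʳ-≡; *-cancelʳ-≡; *-cancelˡ-≡; <-trans; n<1+n)
open import Data.Nat.Divisibility using (divides)
open import Data.Fin using (zero; suc; punchIn; _≟_)
open import Data.Fin.Properties using (any?; punchInᵢ≢i)
open import Data.Fin.Subset using (_∈_; _∉_; ∣_∣)
open import Data.Fin.Subset.Properties using (_∈?_; ⊆-antisym)
open import Data.Fin.Permutation using (Permutation′; _⟨$⟩ʳ_; _⟨$⟩ˡ_; flip; _∘ₚ_; inverseˡ; inverseʳ)
open import Data.Vec using ([]; _∷_; lookup; tabulate)
open import Data.Vec.Properties using (lookup∘tabulate; []=⇒lookup; lookup⇒[]=)
open import Data.Bool using (Bool; true; false; _∧_)
open import Data.Product using (∃; _×_; _,_; proj₁; proj₂)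
open import Relation.Nullary using (yes; no; contradiction)
open import Function.Base using (_∘′_)
open import Relation.Binary.PropositionalEquality
open import Function.Bundles using (_⇔_; Equivalence; mk⇔)
open import Algebra.Properties.Semiring.Sum +-*-semiring
  using (sum; sum-cong-≗; ∑-comm; ∑-permute; sum-remove; *-distribˡ-sum; *-distribʳ-sum)

open Equivalence using (to; from)

sum-const : ∀ n c → sum {n} (λ _ → c) ≡ n * c
sum-const zero    c = refl
sum-const (suc n) c = cong (c +_) (sum-const n c)

-- If every summand except the p-th equals c, the sum is f p plus
-- (n - 1) copies of c; stated without subtraction.
sum-except : ∀ {n} (f : Fin n → ℕ) (p : Fin n) {c} →
  (∀ q → q ≢ p → f q ≡ c) → sum f + c ≡ f p + n * c
sum-except {suc n} f p {c} off = begin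
    sum f + c                            ≡⟨ cong (_+ c) (sum-remove {i = p} f) ⟩
    f p + sum (λ j → f (punchIn p j)) + c ≡⟨ cong (λ w → f p + w + c) others ⟩
    f p + n * c + c                      ≡⟨ +-assoc (f p) (n * c) c ⟩
    f p + (n * c + c)                    ≡⟨ cong (f p +_) (+-comm (n * c) c) ⟩
    f p + suc n * c                      ∎
  where
  open ≡-Reasoning
  others : sum (λ j → f (punchIn p j)) ≡ n * c
  others = trans (sum-cong-≗ (λ j → off (punchIn p j) (punchInᵢ≢i p j))) (sum-const n c)

-- The map a ↦ a * k + λ - a is injective when k > 1; this is what makes
-- the replication number of a 2-design constant.
replication-cancel : ∀ {a c k lam V} → 1 < k →
  a * k + lam ≡ a + V → c * k + lam ≡ c + V → a ≡ c
replication-cancel {a} {c} {suc k′@(suc _)} {lam} {V} (s≤s (s≤s _)) eqa eqc =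
  *-cancelʳ-≡ a c k′ (+-cancelʳ-≡ lam _ _ (trans (drop a eqa) (sym (drop c eqc))))
  where
  open ≡-Reasoning
  drop : ∀ a → a * suc k′ + lam ≡ a + V → a * k′ + lam ≡ V
  drop a eq = +-cancelˡ-≡ a _ _ (begin
    a + (a * k′ + lam) ≡⟨ sym (+-assoc a _ lam) ⟩
    a + a * k′ + lam   ≡⟨ cong (_+ lam) (sym (*-suc a k′)) ⟩
    a * suc k′ + lam   ≡⟨ eq ⟩
    a + V              ∎)

ind : Bool → ℕ
ind true  = 1
ind false = 0

χ : ∀ {n} → Subset n → Fin n → ℕ
χ S p = ind (lookup S p)

card-sum : ∀ {n} (S : Subset n) → ∣ S ∣ ≡ sum (χ S)
card-sum []          = refl
card-sum (true ∷ S)  = cong suc (card-sum S)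
card-sum (false ∷ S) = card-sum S

χ-∈ : ∀ {n} {S : Subset n} {p} → p ∈ S → χ S p ≡ 1
χ-∈ p∈S rewrite []=⇒lookup p∈S = refl

χ-∉ : ∀ {n} {S : Subset n} {p} → p ∉ S → χ S p ≡ 0
χ-∉ {S = S} {p} p∉S with lookup S p in eq
... | true  = contradiction (lookup⇒[]= p S eq) p∉S
... | false = refl

χ-cong : ∀ {n m} {S : Subset n} {T : Subset m} {p q} → (p ∈ S ⇔ q ∈ T) → χ S p ≡ χ T q
χ-cong {S = S} {p = p} p⇔q with p ∈? S
... | yes p∈S = trans (χ-∈ p∈S) (sym (χ-∈ (to p⇔q p∈S)))
... | no  p∉S = trans (χ-∉ p∉S) (sym (χ-∉ (p∉S ∘′ from p⇔q)))

χ-tabulate : ∀ {n} (f : Fin n → Bool) p → χ (tabulate f) p ≡ ind (f p)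
χ-tabulate f p = cong ind (lookup∘tabulate f p)

ind-∧ : ∀ a b → ind (a ∧ b) ≡ ind a * ind b
ind-∧ true  b = sym (+-identityʳ (ind b))
ind-∧ false b = refl

ind-idem : ∀ a → ind a * ind a ≡ ind a
ind-idem true  = refl
ind-idem false = refl

subset-ext : ∀ {n} {S T : Subset n} → (∀ z → z ∈ S ⇔ z ∈ T) → S ≡ T
subset-ext S⇔T = ⊆-antisym (λ {z} → to (S⇔T z)) (λ {z} → from (S⇔T z))

image : ∀ {n} → Permutation′ n → Subset n → Subset n
image g S = tabulate (λ z → lookup S (g ⟨$⟩ˡ z))

∈-image : ∀ {n} (g : Permutation′ n) (S : Subset n) z → z ∈ image g S ⇔ (g ⟨$⟩ˡ z) ∈ S
∈-image g S z = mk⇔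
  (λ z∈ → lookup⇒[]= (g ⟨$⟩ˡ z) S (trans (sym (lookup∘tabulate _ z)) ([]=⇒lookup z∈)))
  (λ ∈S → lookup⇒[]= z (image g S) (trans (lookup∘tabulate _ z) ([]=⇒lookup ∈S)))

∣image∣ : ∀ {n} (g : Permutation′ n) (S : Subset n) → ∣ image g S ∣ ≡ ∣ S ∣
∣image∣ g S = begin
  ∣ image g S ∣                ≡⟨ card-sum (image g S) ⟩
  sum (χ (image g S))          ≡⟨ sum-cong-≗ (χ-tabulate (λ z → lookup S (g ⟨$⟩ˡ z))) ⟩
  sum (λ z → χ S (g ⟨$⟩ˡ z))   ≡⟨ sym (∑-permute (χ S) (flip g)) ⟩
  sum (χ S)                    ≡⟨ sym (card-sum S) ⟩
  ∣ S ∣                        ∎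
  where open ≡-Reasoning

Disjoint : ∀ {n s} → (Fin s → Subset n) → Set
Disjoint S = ∀ i j p → p ∈ S i → p ∈ S j → i ≡ j

-- The number of members of the family S containing p; for a disjoint
-- family this is the indicator of the union.
multiplicity : ∀ {n s} → (Fin s → Subset n) → Fin n → ℕ
multiplicity S p = sum (λ i → χ (S i) p)

multiplicity-∈ : ∀ {n s} {S : Fin s → Subset n} → Disjoint S →
  ∀ {i p} → p ∈ S i → multiplicity S p ≡ 1
multiplicity-∈ {s = s} {S} disjoint {i} {p} p∈Si = begin
  multiplicity S p         ≡⟨ sym (+-identityʳ _) ⟩
  multiplicity S p + 0     ≡⟨ sum-except (λ j → χ (S j) p) i off ⟩
  χ (S i) p + s * 0        ≡⟨ cong₂ _+_ (χ-∈ p∈Si) (*-zeroʳ s) ⟩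
  1                        ∎
  where
  open ≡-Reasoning
  off : ∀ j → j ≢ i → χ (S j) p ≡ 0
  off j j≢i = χ-∉ (λ p∈Sj → j≢i (disjoint j i p p∈Sj p∈Si))

multiplicity-∉ : ∀ {n s} {S : Fin s → Subset n} {p} → (∀ i → p ∉ S i) → multiplicity S p ≡ 0
multiplicity-∉ {s = s} p∉ =
  trans (sum-cong-≗ (λ i → χ-∉ (p∉ i))) (trans (sum-const s 0) (*-zeroʳ s))

multiplicity-cong : ∀ {n s} {S : Fin s → Subset n} → Disjoint S → ∀ {p q} →
  (∃ (λ i → p ∈ S i) ⇔ ∃ (λ i → q ∈ S i)) → multiplicity S p ≡ multiplicity S q
multiplicity-cong {S = S} disjoint {p} {q} p⇔q with any? (λ i → p ∈? S i)
... | yes (i , p∈Si) = trans (multiplicity-∈ disjoint p∈Si)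
                             (sym (multiplicity-∈ disjoint (proj₂ (to p⇔q (i , p∈Si)))))
... | no  p∉∪S = trans (multiplicity-∉ (λ i p∈Si → p∉∪S (i , p∈Si)))
                       (sym (multiplicity-∉ (λ i q∈Si → p∉∪S (from p⇔q (i , q∈Si)))))

sum-multiplicity : ∀ {n s} (S : Fin s → Subset n) → sum (multiplicity S) ≡ sum (λ i → ∣ S i ∣)
sum-multiplicity S =
  trans (∑-comm (λ p i → χ (S i) p)) (sum-cong-≗ (λ i → sym (card-sum (S i))))

IsStabInvariant : ∀ {v} → PermGroup v → Fin v → (Fin v → ℕ) → Set
IsStabInvariant G x u = ∀ g → mem G g → g ⟨$⟩ʳ x ≡ x → ∀ p → u (g ⟨$⟩ʳ p) ≡ u p

module Design {v b k lam : ℕ} (B : Fin b → Subset v)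
              (blockSize : ∀ j → ∣ B j ∣ ≡ k)
              (pairs : ∀ p q → p ≢ q → pairCount B p q ≡ lam) where

  open ≡-Reasoning

  r : Fin v → ℕ
  r p = sum (λ j → χ (B j) p)

  -- The weight of a block j with respect to a weight u on points;
  -- for u the indicator of a set U this is ∣B j ∩ U∣.
  blockWeight : (Fin v → ℕ) → Fin b → ℕ
  blockWeight u j = sum (λ p → χ (B j) p * u p)

  pairCount-sum : ∀ p q → pairCount B p q ≡ sum (λ j → χ (B j) p * χ (B j) q)
  pairCount-sum p q = trans (card-sum (tabulate inBoth)) (sum-cong-≗ (λ j →
    trans (χ-tabulate inBoth j) (ind-∧ (lookup (B j) p) (lookup (B j) q))))
    where
    inBoth : Fin b → Bool
    inBoth j = lookup (B j) p ∧ lookup (B j) q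

  blockSize-sum : ∀ j → sum (χ (B j)) ≡ k
  blockSize-sum j = trans (sym (card-sum (B j))) (blockSize j)

  replication-pairs : ∀ p → r p * k ≡ sum (pairCount B p)
  replication-pairs p = begin
    r p * k                                            ≡⟨ *-distribʳ-sum k (λ j → χ (B j) p) ⟩
    sum (λ j → χ (B j) p * k)                          ≡⟨ sum-cong-≗ (λ j → cong (χ (B j) p *_) (sym (blockSize-sum j))) ⟩
    sum (λ j → χ (B j) p * sum (χ (B j)))             ≡⟨ sum-cong-≗ (λ j → *-distribˡ-sum (χ (B j) p) (χ (B j))) ⟩
    sum (λ j → sum (λ q → χ (B j) p * χ (B j) q))     ≡⟨ ∑-comm (λ j q → χ (B j) p * χ (B j) q) ⟩
    sum (λ q → sum (λ j → χ (B j) p * χ (B j) q))     ≡⟨ sum-cong-≗ (λ q → sym (pairCount-sum p q)) ⟩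
    sum (pairCount B p)                                ∎

  -- The equation r (k - 1) = λ (v - 1), written without subtraction.
  replication-equation : ∀ p → r p * k + lam ≡ r p + v * lam
  replication-equation p = begin
    r p * k + lam                ≡⟨ cong (_+ lam) (replication-pairs p) ⟩
    sum (pairCount B p) + lam    ≡⟨ sum-except (pairCount B p) p (λ q q≢p → pairs p q (q≢p ∘′ sym)) ⟩
    pairCount B p p + v * lam    ≡⟨ cong (_+ v * lam) diagonal ⟩
    r p + v * lam                ∎
    where
    diagonal : pairCount B p p ≡ r p
    diagonal = trans (pairCount-sum p p) (sum-cong-≗ (λ j → ind-idem (lookup (B j) p)))

  sum-replication : sum r ≡ b * k
  sum-replication =
    trans (∑-comm (λ p j → χ (B j) p)) (trans (sum-cong-≗ blockSize-sum) (sum-const b k))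

  replication-symmetric : 1 < k → b ≡ v → ∀ p → r p ≡ k
  replication-symmetric 1<k b≡v p = *-cancelˡ-≡ (r p) k v {{nonEmpty p}} (begin
    v * r p                 ≡⟨ sym (sum-const v (r p)) ⟩
    sum {v} (λ _ → r p)     ≡⟨ sum-cong-≗ (λ q → replication-cancel 1<k (replication-equation p) (replication-equation q)) ⟩
    sum r                   ≡⟨ sum-replication ⟩
    b * k                   ≡⟨ cong (_* k) b≡v ⟩
    v * k                   ∎)
    where
    nonEmpty : ∀ {n} → Fin n → NonZero n
    nonEmpty zero    = _
    nonEmpty (suc _) = _

  -- Counting pairs (B, p) with x ∈ B, weighted by u p: if u vanishes at
  -- x, every other point is counted on λ blocks through x.
  flag-weight-count : ∀ x (u : Fin v → ℕ) → u x ≡ 0 →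
    sum (λ j → χ (B j) x * blockWeight u j) ≡ lam * sum u
  flag-weight-count x u ux≡0 = begin
    sum (λ j → χ (B j) x * blockWeight u j)               ≡⟨ sum-cong-≗ (λ j → *-distribˡ-sum (χ (B j) x) (λ p → χ (B j) p * u p)) ⟩
    sum (λ j → sum (λ p → χ (B j) x * (χ (B j) p * u p))) ≡⟨ ∑-comm (λ j p → χ (B j) x * (χ (B j) p * u p)) ⟩
    sum (λ p → sum (λ j → χ (B j) x * (χ (B j) p * u p))) ≡⟨ sum-cong-≗ through ⟩
    sum (λ p → lam * u p)                                 ≡⟨ sym (*-distribˡ-sum lam u) ⟩
    lam * sum u                                           ∎
    where
    pairs-weighted : ∀ p → pairCount B x p * u p ≡ lam * u p
    pairs-weighted p with x ≟ p
    ... | yes refl rewrite ux≡0 = trans (*-zeroʳ (pairCount B x x)) (sym (*-zeroʳ lam))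
    ... | no x≢p   = cong (_* u p) (pairs x p x≢p)
    through : ∀ p → sum (λ j → χ (B j) x * (χ (B j) p * u p)) ≡ lam * u p
    through p = begin
      sum (λ j → χ (B j) x * (χ (B j) p * u p)) ≡⟨ sum-cong-≗ (λ j → sym (*-assoc (χ (B j) x) _ _)) ⟩
      sum (λ j → χ (B j) x * χ (B j) p * u p)   ≡⟨ sym (*-distribʳ-sum (u p) (λ j → χ (B j) x * χ (B j) p)) ⟩
      sum (λ j → χ (B j) x * χ (B j) p) * u p   ≡⟨ cong (_* u p) (sym (pairCount-sum x p)) ⟩
      pairCount B x p * u p                     ≡⟨ pairs-weighted p ⟩
      lam * u p                                 ∎

  -- G_x is transitive on the blocks through x (flag-transitivity), so a
  -- G_x-invariant weight gives all of them the same weight.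
  flag-transitive-weight : (G : PermGroup v) → IsFlagTransitive B G →
    ∀ {x u} → IsStabInvariant G x u → ∀ {i j} → x ∈ B i → x ∈ B j →
    blockWeight u i ≡ blockWeight u j
  flag-transitive-weight G flagTransitive {x} {u} invariant {i} {j} x∈Bi x∈Bj
    with flagTransitive x i x j x∈Bi x∈Bj
  ... | g , g∈G , gx≡x , Bi↦Bj = begin
    blockWeight u i                                  ≡⟨ sum-cong-≗ (λ p → cong₂ _*_ (χ-cong (Bi↦Bj p)) (sym (invariant g g∈G gx≡x p))) ⟩
    sum (λ p → χ (B j) (g ⟨$⟩ʳ p) * u (g ⟨$⟩ʳ p))  ≡⟨ sym (∑-permute (λ p → χ (B j) p * u p) g) ⟩
    blockWeight u j                                  ∎

  -- Double counting against a common block weight c: λ Σ u = r x * c,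
  -- hence r x divides λ Σ u for every G_x-invariant weight vanishing at x.
  replication-divides : (G : PermGroup v) → IsFlagTransitive B G →
    ∀ x (u : Fin v → ℕ) → u x ≡ 0 → IsStabInvariant G x u → r x ∣ lam * sum u
  replication-divides G flagTransitive x u ux≡0 invariant with any? (λ j → x ∈? B j)
  ... | yes (j₀ , x∈Bj₀) = divides (blockWeight u j₀) (begin
    lam * sum u                               ≡⟨ sym (flag-weight-count x u ux≡0) ⟩
    sum (λ j → χ (B j) x * blockWeight u j)  ≡⟨ sum-cong-≗ common ⟩
    sum (λ j → χ (B j) x * blockWeight u j₀) ≡⟨ sym (*-distribʳ-sum (blockWeight u j₀) (λ j → χ (B j) x)) ⟩
    r x * blockWeight u j₀                    ≡⟨ *-comm (r x) _ ⟩
    blockWeight u j₀ * r x                    ∎)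
    where
    common : ∀ j → χ (B j) x * blockWeight u j ≡ χ (B j) x * blockWeight u j₀
    common j with x ∈? B j
    ... | yes x∈Bj = cong (χ (B j) x *_) (flag-transitive-weight G flagTransitive invariant x∈Bj x∈Bj₀)
    ... | no  x∉Bj rewrite χ-∉ x∉Bj = refl
  ... | no noBlock = divides 0 (begin
    lam * sum u                               ≡⟨ sym (flag-weight-count x u ux≡0) ⟩
    sum (λ j → χ (B j) x * blockWeight u j)  ≡⟨ sum-cong-≗ (λ j → cong (_* blockWeight u j) (χ-∉ (λ x∈Bj → noBlock (j , x∈Bj)))) ⟩
    sum {b} (λ _ → 0)                         ≡⟨ trans (sum-const b 0) (*-zeroʳ b) ⟩
    0                                         ∎)

-- X is closed under conjugation by elements of G (i.e. normalised by G).
-- Since ∘ₚ composes left to right, flip g ∘ₚ (h ∘ₚ g) is the conjugate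
-- g h g⁻¹, the map p ↦ g (h (g⁻¹ p)).
IsNormalisedBy : ∀ {v} → PermGroup v → PermGroup v → Set
IsNormalisedBy X G = ∀ g h → mem G g → mem X h → mem X (flip g ∘ₚ (h ∘ₚ g))

-- The socle is normalised by G: for fixed g ∈ G, the elements h with
-- g h g⁻¹ ∈ X form a subgroup containing every minimal normal subgroup,
-- so it contains the socle X.
socle-normalised : ∀ {v} {X G : PermGroup v} → IsSocle X G → IsNormalisedBy X G
socle-normalised {v} {X} {G} (minimal⊆X , X-least) g h g∈G h∈X =
  X-least conjugatesIntoX (λ N minimal n n∈N →
    minimal⊆X N minimal _ (proj₂ (proj₁ minimal) g n g∈G n∈N)) h h∈X
  where
  conjugatesIntoX : PermGroup v
  conjugatesIntoX = record
    { mem     = λ h → mem X (flip g ∘ₚ (h ∘ₚ g))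
    ; mem-≈   = λ h≈h′ → mem-≈ X (λ p → cong (g ⟨$⟩ʳ_) (h≈h′ (g ⟨$⟩ˡ p)))
    ; mem-id  = mem-≈ X (λ p → sym (inverseʳ g)) (mem-id X)
    ; mem-∘   = λ {h₁} {h₂} h₁∈ h₂∈ →
        mem-≈ X (λ p → cong (λ q → g ⟨$⟩ʳ (h₂ ⟨$⟩ʳ q)) (inverseˡ g)) (mem-∘ X h₁∈ h₂∈)
    ; mem-inv = λ h∈ → mem-≈ X (λ p → refl) (mem-inv X h∈)
    }

StabRelated : ∀ {v} → PermGroup v → Fin v → Fin v → Fin v → Set
StabRelated X x a z = ∃ λ h → mem X h × h ⟨$⟩ʳ x ≡ x × h ⟨$⟩ʳ a ≡ z

module Orbits {v} (X : PermGroup v) (x : Fin v) where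

  related-sym : ∀ {a z} → StabRelated X x a z → StabRelated X x z a
  related-sym (h , h∈X , hx≡x , ha≡z) = flip h , mem-inv X h∈X ,
    trans (cong (h ⟨$⟩ˡ_) (sym hx≡x)) (inverseˡ h) ,
    trans (cong (h ⟨$⟩ˡ_) (sym ha≡z)) (inverseˡ h)

  related-trans : ∀ {a b c} → StabRelated X x a b → StabRelated X x b c → StabRelated X x a c
  related-trans (h₁ , h₁∈X , h₁x , h₁a) (h₂ , h₂∈X , h₂x , h₂b) = h₁ ∘ₚ h₂ , mem-∘ X h₁∈X h₂∈X ,
    trans (cong (h₂ ⟨$⟩ʳ_) h₁x) h₂x , trans (cong (h₂ ⟨$⟩ʳ_) h₁a) h₂b

  orbits-meet : ∀ {O O′} → IsStabOrbit X x O → IsStabOrbit X x O′ →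
    ∀ {p} → p ∈ O → p ∈ O′ → O ≡ O′
  orbits-meet (y , orbitY) (y′ , orbitY′) {p} p∈O p∈O′ = subset-ext λ z → mk⇔
    (λ z∈O → from (orbitY′ z) (related-trans y′~p (related-trans (related-sym y~p) (to (orbitY z) z∈O))))
    (λ z∈O′ → from (orbitY z) (related-trans y~p (related-trans (related-sym y′~p) (to (orbitY′ z) z∈O′))))
    where
    y~p  = to (orbitY p) p∈O
    y′~p = to (orbitY′ p) p∈O′

  inverse-fixes : ∀ (g : Permutation′ v) → g ⟨$⟩ʳ x ≡ x → g ⟨$⟩ˡ x ≡ x
  inverse-fixes g gx≡x = trans (cong (g ⟨$⟩ˡ_) (sym gx≡x)) (inverseˡ g)

  module Normalised {G : PermGroup v} (normalised : IsNormalisedBy X G) where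

    -- Conjugating by g ∈ G_x carries h ∈ X_x with h a = z to g h g⁻¹ ∈ X_x,
    -- which maps g a to g z.
    related-image : ∀ {g} → mem G g → g ⟨$⟩ʳ x ≡ x →
      ∀ {a z} → StabRelated X x a z → StabRelated X x (g ⟨$⟩ʳ a) (g ⟨$⟩ʳ z)
    related-image {g} g∈G gx≡x (h , h∈X , hx≡x , ha≡z) =
      h′ , normalised g h g∈G h∈X ,
      trans (cong (h′ ⟨$⟩ʳ_) (sym gx≡x)) (trans (conjugate x) (trans (cong (g ⟨$⟩ʳ_) hx≡x) gx≡x)) ,
      trans (conjugate _) (cong (g ⟨$⟩ʳ_) ha≡z)
      where
      h′ : Permutation′ v
      h′ = flip g ∘ₚ (h ∘ₚ g)
      conjugate : ∀ p → h′ ⟨$⟩ʳ (g ⟨$⟩ʳ p) ≡ g ⟨$⟩ʳ (h ⟨$⟩ʳ p)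
      conjugate p = cong (λ q → g ⟨$⟩ʳ (h ⟨$⟩ʳ q)) (inverseˡ g)

    image-orbit : ∀ {g} → mem G g → g ⟨$⟩ʳ x ≡ x → ∀ {t O} →
      IsNontrivialStabOrbitOfLength X x t O → IsNontrivialStabOrbitOfLength X x t (image g O)
    image-orbit {g} g∈G gx≡x {t} {O} ((y , orbitY) , x∉O , ∣O∣≡t) =
      (g ⟨$⟩ʳ y , λ z → mk⇔ (forward z) (backward z)) ,
      (λ x∈gO → x∉O (subst (_∈ O) (inverse-fixes g gx≡x) (to (∈-image g O x) x∈gO))) ,
      trans (∣image∣ g O) ∣O∣≡t
      where
      forward : ∀ z → z ∈ image g O → StabRelated X x (g ⟨$⟩ʳ y) z
      forward z z∈gO = subst (StabRelated X x _) (inverseʳ g)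
        (related-image g∈G gx≡x (to (orbitY _) (to (∈-image g O z) z∈gO)))
      backward : ∀ z → StabRelated X x (g ⟨$⟩ʳ y) z → z ∈ image g O
      backward z gy~z = from (∈-image g O z) (from (orbitY _)
        (subst₂ (StabRelated X x) (inverseˡ g) refl
          (related-image (mem-inv G g∈G) (inverse-fixes g gx≡x) gy~z)))

    -- The union U of the enumerated orbits of length t, through its
    -- indicator: U avoids x, has s t points, and is G_x-invariant.
    module Union {t s} {Os : Fin s → Subset v} (enum : EnumeratesOrbitsOfLength X x t s Os) where

      -- Each Os i is an orbit of length t, and distinct indices give
      -- distinct, hence disjoint, orbits.
      isOrbit : ∀ i → IsNontrivialStabOrbitOfLength X x t (Os i)
      isOrbit = proj₁ enum

      orbits-disjoint : Disjoint Os
      orbits-disjoint i j p p∈Osi p∈Osj =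
        proj₁ (proj₂ enum) i j (orbits-meet (proj₁ (isOrbit i)) (proj₁ (isOrbit j)) p∈Osi p∈Osj)

      -- G_x maps the union into itself, as it permutes the orbits of length t.
      union-image : ∀ {g} → mem G g → g ⟨$⟩ʳ x ≡ x →
        ∀ {i p} → p ∈ Os i → ∃ λ j → g ⟨$⟩ʳ p ∈ Os j
      union-image {g} g∈G gx≡x {i} {p} p∈Osi
        with proj₂ (proj₂ enum) (image g (Os i)) (image-orbit g∈G gx≡x (isOrbit i))
      ... | j , Osj≡gOsi = j , subst (g ⟨$⟩ʳ p ∈_) (sym Osj≡gOsi)
        (from (∈-image g (Os i) _) (subst (_∈ Os i) (sym (inverseˡ g)) p∈Osi))

      -- G_x preserves membership in U in both directions (g⁻¹ ∈ G_x too).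
      union-invariant : IsStabInvariant G x (multiplicity Os)
      union-invariant g g∈G gx≡x p = multiplicity-cong orbits-disjoint (mk⇔
        (λ (i , gp∈Osi) → let j , g⁻¹gp∈Osj = union-image (mem-inv G g∈G) (inverse-fixes g gx≡x) gp∈Osi
                           in j , subst (_∈ Os j) (inverseˡ g) g⁻¹gp∈Osj)
        (λ (i , p∈Osi) → union-image g∈G gx≡x p∈Osi))

      union-avoids-x : multiplicity Os x ≡ 0
      union-avoids-x = multiplicity-∉ (λ i → proj₁ (proj₂ (isOrbit i)))

      union-size : sum (multiplicity Os) ≡ s * t
      union-size = trans (sum-multiplicity Os)
        (trans (sum-cong-≗ (λ i → proj₂ (proj₂ (isOrbit i)))) (sum-const s t))

-- The indicator of the union U of the s orbits of length t is a
-- G_x-invariant weight vanishing at x with total weight s t, so r x = k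
-- divides λ s t.
lemma2p6 : (v b k lam : ℕ) (B : Fin b → Subset v) (G X : PermGroup v)
    → IsNontrivialSymmetric v b k lam B
    → IsAutGroup B G → IsFlagTransitive B G → IsPrimitive G
    → X ≤G G → IsSocle X G
    → (x : Fin v) (t s : ℕ) (Os : Fin s → Subset v)
    → IsNontrivialSubdegree X x t
    → EnumeratesOrbitsOfLength X x t s Os
    → k ∣ lam * s * t
lemma2p6 v .v k lam B G X ((blockSize , pairs) , refl , 2<k , _) _ flagTransitive _ _ socle
         x t s Os _ enum =
  subst₂ _∣_ (replication-symmetric 1<k refl x) weight≡λst
    (replication-divides G flagTransitive x (multiplicity Os) union-avoids-x union-invariant)
  where
  open Design B blockSize pairs
  open Orbits.Normalised X x {G} (socle-normalised {X = X} {G} socle)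
  open Union enum

  1<k : 1 < k
  1<k = <-trans (n<1+n 1) 2<k

  weight≡λst : lam * sum (multiplicity Os) ≡ lam * s * t
  weight≡λst = trans (cong (lam *_) union-size) (sym (*-assoc lam s t))
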